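{- For any $k$ there exist process templates $A,B$ with $|B|=k$ such that, in disjunctive systems and considering only runs that are strong-fair or finite, $(A,B)^{(1,2|B|-2)}$ does not have a deadlocked run that is strong-fair or finite, but $(A,B)^{(1,2|B|-1)}$ does.
   Context: A process template is $U=(Q_U,\mathrm{init}_U,\Sigma_U,\delta_U)$ with finite state set $Q_U$ containing initial state $\mathrm{init}_U$, finite input alphabet $\Sigma_U$, and guarded transition relation $\delta_U \subseteq Q_U \times \Sigma_U \times \mathcal{P}(Q_A \cup Q_B) \times Q_U$. $Q_A,Q_B$ are disjoint, as are the alphabets; $|B|=|Q_B|$. The system $(A,B)^{(1,n)}$ consists of one copy of $A$ and $n$ copies $B_1,\dots,B_n$ of $B$ in interleaving composition, starting with all processes in their initial states. A local transition $(q,\sigma,g,q')$ of process $p$ is enabled in global state $s$ with global input $e$ if $s(p)=q$, $e(p)=\sigma$ and (disjunctive interpretation) some process $p'\neq p$ has $s(p')\in g$. A process is enabled if one of its transitions is enabled; each global step moves exactly one process along an enabled local transition. A run is a maximal sequence of configurations $(s_t,e_t,p_t)$ from the initial state ($p_t$ is the moving process; a configuration $(s,e,\bot)$ occurs exactly when all processes are disabled, ending the run), in which the input to a process changes only at moments at which that process moves. A run is globally deadlocked if it is finite, locally deadlocked if it is infinite and some process is disabled at all moments from some point on, and deadlocked if either. A run is strong-fair if it is infinite and every process that is enabled infinitely often moves infinitely often. -}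

module Defs where

open import Data.Nat using (ℕ; zero; suc; _≤_; _<_)
open import Data.Fin using (Fin; zero; suc)
open import Data.Bool using (Bool; true)
open import Data.Sum using (_⊎_; inj₁; inj₂)
open import Data.Product using (Σ; _×_; _,_; ∃-syntax)
open import Data.List using (List)
open import Data.List.Membership.Propositional using (_∈_)
open import Relation.Binary.PropositionalEquality using (_≡_; _≢_)
open import Relation.Nullary using (¬_)

Loc : ℕ → ℕ → Set
Loc qa qb = Fin qa ⊎ Fin qb

Guard : ℕ → ℕ → Set
Guard qa qb = Loc qa qb → Bool

record Template (qa qb m : ℕ) : Set where
  field
    nΣ   : ℕ
    init : Fin m
    δ    : List (Fin m × Fin nΣ × Guard qa qb × Fin m)

open Template public

-- The system (A,B)^(1,n): process zero is A, process (suc i) is B_(i+1).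
module System {qa qb : ℕ} (A : Template qa qb qa) (B : Template qa qb qb) (n : ℕ) where

  Proc : Set
  Proc = Fin (suc n)

  record GState : Set where
    field
      sA : Fin qa
      sB : Fin n → Fin qb
  open GState public

  record GInput : Set where
    field
      eA : Fin (nΣ A)
      eB : Fin n → Fin (nΣ B)
  open GInput public

  loc : GState → Proc → Loc qa qb
  loc s zero    = inj₁ (sA s)
  loc s (suc i) = inj₂ (sB s i)

  GuardHolds : GState → Proc → Guard qa qb → Set
  GuardHolds s p g = ∃[ p' ] (p' ≢ p × g (loc s p') ≡ true)

  LEnabled : {m : ℕ} (U : Template qa qb m) → Proc → Fin m → Fin (nΣ U) → GState
           → (Fin m × Fin (nΣ U) × Guard qa qb × Fin m) → Set
  LEnabled U p cur inp s (q , σ , g , q') =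
    ((q , σ , g , q') ∈ δ U) × q ≡ cur × σ ≡ inp × GuardHolds s p g

  target : {m k : ℕ} {X : Set} → (Fin m × Fin k × X × Fin m) → Fin m
  target (_ , _ , _ , q') = q'

  Enabled : GState → GInput → Proc → Set
  Enabled s e zero    = ∃[ tr ] LEnabled A zero (sA s) (eA e) s tr
  Enabled s e (suc i) = ∃[ tr ] LEnabled B (suc i) (sB s i) (eB e i) s tr

  AllDisabled : GState → GInput → Set
  AllDisabled s e = (p : Proc) → ¬ Enabled s e p

  Moves : GState → GInput → Proc → GState → Set
  Moves s e zero s' =
    (∃[ tr ] (LEnabled A zero (sA s) (eA e) s tr × target tr ≡ sA s'))
    × ((j : Fin n) → sB s' j ≡ sB s j)
  Moves s e (suc i) s' =
    (∃[ tr ] (LEnabled B (suc i) (sB s i) (eB e i) s tr × target tr ≡ sB s' i))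
    × sA s' ≡ sA s
    × ((j : Fin n) → j ≢ i → sB s' j ≡ sB s j)

  -- the input of a process may only change when that process moves
  InputFrame : GInput → Proc → GInput → Set
  InputFrame e zero e' = (j : Fin n) → eB e' j ≡ eB e j
  InputFrame e (suc i) e' = eA e' ≡ eA e × ((j : Fin n) → j ≢ i → eB e' j ≡ eB e j)

  IsInitial : GState → Set
  IsInitial s = sA s ≡ init A × ((j : Fin n) → sB s j ≡ init B)

  record InfRun : Set where
    field
      st      : ℕ → GState
      inp     : ℕ → GInput
      mv      : ℕ → Proc
      start   : IsInitial (st 0)
      step    : (t : ℕ) → Moves (st t) (inp t) (mv t) (st (suc t))
      inFrame : (t : ℕ) → InputFrame (inp t) (mv t) (inp (suc t))

  -- finite runs: configurations (st t , inp t , mv t) for t < len, and a final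
  -- configuration (st len , inp len , ⊥) in which all processes are disabled
  -- (values of st, inp, mv beyond these indices are irrelevant)
  record FinRun : Set where
    field
      len     : ℕ
      st      : ℕ → GState
      inp     : ℕ → GInput
      mv      : ℕ → Proc
      start   : IsInitial (st 0)
      step    : (t : ℕ) → t < len → Moves (st t) (inp t) (mv t) (st (suc t))
      inFrame : (t : ℕ) → t < len → InputFrame (inp t) (mv t) (inp (suc t))
      final   : AllDisabled (st len) (inp len)

  Run : Set
  Run = InfRun ⊎ FinRun

  IsFinite : Run → Set
  IsFinite r = Σ FinRun (λ f → r ≡ inj₂ f)

  GloballyDeadlocked : Run → Set
  GloballyDeadlocked = IsFinite

  LocallyDeadlocked : Run → Set
  LocallyDeadlocked (inj₁ r) =
    ∃[ p ] ∃[ T ] ((t : ℕ) → T ≤ t → ¬ Enabled (InfRun.st r t) (InfRun.inp r t) p)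
  LocallyDeadlocked (inj₂ _) = Data.Empty.⊥
    where import Data.Empty

  Deadlocked : Run → Set
  Deadlocked r = GloballyDeadlocked r ⊎ LocallyDeadlocked r

  StrongFair : Run → Set
  StrongFair (inj₁ r) = (p : Proc)
    → ((T : ℕ) → ∃[ t ] (T ≤ t × Enabled (InfRun.st r t) (InfRun.inp r t) p))
    → ((T : ℕ) → ∃[ t ] (T ≤ t × InfRun.mv r t ≡ p))
  StrongFair (inj₂ _) = Data.Empty.⊥
    where import Data.Empty

  HasFairOrFiniteDeadlock : Set
  HasFairOrFiniteDeadlock = ∃[ r ] (Deadlocked r × (StrongFair r ⊎ IsFinite r))

HasFairOrFiniteDeadlock : {qa qb : ℕ} → Template qa qb qa → Template qa qb qb → ℕ → Set
HasFairOrFiniteDeadlock A B n = System.HasFairOrFiniteDeadlock A B n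

-- B has an idle state and L = k − 1 busy states; A cycles through L slots and may only leave
-- slot p while some B is in busy state p. A is always enabled, so a fair deadlocked run must
-- locally deadlock some B. That B is then idle for ever, which forces every other process to be
-- busy, the other B's to keep their states and, by strong fairness, each busy B to keep finding
-- a partner in its own state. Fairness also drives A through all slots, so every busy state
-- holds two B's: with the idle one that makes 2L + 1 = 2k − 1 copies. Conversely, 2k − 1 copies
-- realise exactly this configuration in a strong-fair run.
module Submission where

open import Data.Nat using (ℕ; _≤_; _*_; _∸_)
open import Data.Product using (Σ; _×_; ∃-syntax)
open import Relation.Nullary using (¬_)
open import Defs

open import Data.Bool using (true; false)
open import Data.Empty using (⊥-elim)
open import Data.Fin using (Fin; zero; suc; toℕ; fromℕ; fromℕ<; inject₁; splitAt; join; _↑ˡ_)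
open import Data.Fin.Induction using (<-weakInduction; >-weakInduction)
open import Data.Fin.Properties
  using ( _≟_; 0≢1+n; suc-injective; toℕ-injective; toℕ-fromℕ<; toℕ<n; injective⇒≤
        ; join-splitAt; splitAt-join; splitAt-↑ˡ )
open import Data.List using (List; _∷_; map; _++_; allFin)
open import Data.List.Membership.Propositional using (_∈_)
open import Data.List.Membership.Propositional.Properties
  using (∈-map⁺; ∈-map⁻; ∈-++⁺ˡ; ∈-++⁺ʳ; ∈-++⁻; ∈-allFin)
open import Data.List.Relation.Unary.Any using (here; there)
open import Data.Nat using (zero; suc; z≤n; s≤s; _<_; _≤′_; ≤′-reflexive; ≤′-step; _+_; _%_)
open import Data.Nat.DivMod using (_mod_; [m+kn]%n≡m%n; m<n⇒m%n≡m)
open import Data.Nat.Properties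
  using ( ≤-refl; ≤-reflexive; ≤-trans; m≤n⇒m≤1+n; <⇒≤; m≤m+n; m≤n+m; m≤m*n; m∸n+n≡m
        ; +-suc; +-identityʳ; 1+n≰n; ≤⇒≤′; ≤′⇒≤; _<?_; ≮⇒≥ )
open import Data.Product using (_,_; proj₁; proj₂)
open import Data.Sum using (_⊎_; inj₁; inj₂; reduce; swap)
open import Data.Sum.Properties using (inj₁-injective; inj₂-injective)
open import Data.Vec.Functional using (updateAt)
open import Data.Vec.Functional.Properties using (updateAt-updates; updateAt-minimal)
open import Function using (_∘_; const)
open import Relation.Binary.PropositionalEquality
  using (_≡_; _≢_; refl; sym; trans; cong; subst; module ≡-Reasoning)
open import Relation.Nullary using (yes; no; does)
open import Relation.Nullary.Decidable using (dec-true)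

induction-from : ∀ (P : ℕ → Set) {T} → P T → (∀ t → T ≤ t → P t → P (suc t)) → ∀ {t} → T ≤ t → P t
induction-from P {T} base step T≤t = go (≤⇒≤′ T≤t)
  where
  go : ∀ {t} → T ≤′ t → P t
  go (≤′-reflexive refl) = base
  go (≤′-step {t} T≤′t) = step t (≤′⇒≤ T≤′t) (go T≤′t)

paired-fibres⇒≤ : ∀ {n L} (c : Fin n → Fin (suc L)) {v} → c v ≡ zero →
                  (∀ p → ∃[ i ] ∃[ j ] (i ≢ j × c i ≡ suc p × c j ≡ suc p)) → suc (L + L) ≤ n
paired-fibres⇒≤ {n} {L} c {v} cv≡0 pairs = injective⇒≤ pick-injective
  where
  member : Fin L ⊎ Fin L → Fin n
  member (inj₁ p) = proj₁ (pairs p)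
  member (inj₂ p) = proj₁ (proj₂ (pairs p))

  c-member : ∀ s → c (member s) ≡ suc (reduce s)
  c-member (inj₁ p) = proj₁ (proj₂ (proj₂ (proj₂ (pairs p))))
  c-member (inj₂ p) = proj₂ (proj₂ (proj₂ (proj₂ (pairs p))))

  same-slot : ∀ s s' → member s ≡ member s' → reduce s ≡ reduce s'
  same-slot s s' e = suc-injective (trans (sym (c-member s)) (trans (cong c e) (c-member s')))

  member-injective : ∀ s s' → member s ≡ member s' → s ≡ s'
  member-injective (inj₁ p) (inj₁ p') e = cong inj₁ (same-slot (inj₁ p) (inj₁ p') e)
  member-injective (inj₂ p) (inj₂ p') e = cong inj₂ (same-slot (inj₂ p) (inj₂ p') e)
  member-injective (inj₁ p) (inj₂ p') e with refl ← same-slot (inj₁ p) (inj₂ p') e =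
    ⊥-elim (proj₁ (proj₂ (proj₂ (pairs p))) e)
  member-injective (inj₂ p) (inj₁ p') e with refl ← same-slot (inj₂ p) (inj₁ p') e =
    ⊥-elim (proj₁ (proj₂ (proj₂ (pairs p))) (sym e))

  pick : Fin (suc (L + L)) → Fin n
  pick zero = v
  pick (suc j) = member (splitAt L j)

  v≢member : ∀ s → v ≢ member s
  v≢member s e = 0≢1+n (trans (sym cv≡0) (trans (cong c e) (c-member s)))

  splitAt-injective : ∀ j j' → splitAt L j ≡ splitAt L j' → j ≡ j'
  splitAt-injective j j' e =
    trans (sym (join-splitAt L L j)) (trans (cong (join L L) e) (join-splitAt L L j'))

  pick-injective : ∀ {x y} → pick x ≡ pick y → x ≡ y
  pick-injective {zero} {zero} _ = refl
  pick-injective {zero} {suc j} e = ⊥-elim (v≢member (splitAt L j) e)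
  pick-injective {suc j} {zero} e = ⊥-elim (v≢member (splitAt L j) (sym e))
  pick-injective {suc j} {suc j'} e =
    cong suc (splitAt-injective j j' (member-injective (splitAt L j) (splitAt L j') e))

module RunProperties {qa qb : ℕ} (A : Template qa qb qa) (B : Template qa qb qb) (n : ℕ) where
  open System A B n

  loc-frame : ∀ {s e q s' p} → Moves s e q s' → q ≢ p → loc s' p ≡ loc s p
  loc-frame {q = zero}  {p = zero}  _             q≢p = ⊥-elim (q≢p refl)
  loc-frame {q = zero}  {p = suc j} (_ , sB≡)     _   = cong inj₂ (sB≡ j)
  loc-frame {q = suc i} {p = zero}  (_ , sA≡ , _) _   = cong inj₁ sA≡
  loc-frame {q = suc i} {p = suc j} (_ , _ , sB≡) q≢p =
    cong inj₂ (sB≡ j (λ j≡i → q≢p (cong suc (sym j≡i))))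

  module _ (r : InfRun) where
    open InfRun r

    step-by : ∀ {t p} → mv t ≡ p → Moves (st t) (inp t) p (st (suc t))
    step-by {t} refl = step t

    next-move : ∀ {p t₀} d → mv (d + t₀) ≡ p →
                ∃[ t ] (t₀ ≤ t × loc (st t) p ≡ loc (st t₀) p × mv t ≡ p)
    next-move {t₀ = t₀} zero mv≡ = t₀ , ≤-refl , refl , mv≡
    next-move {p} {t₀} (suc d) mv≡ with mv t₀ ≟ p
    ... | yes mv₀≡ = t₀ , ≤-refl , refl , mv₀≡
    ... | no mv₀≢ =
      let t , t₀<t , loc≡ , mvt≡ =
            next-move {t₀ = suc t₀} d (subst (λ t → mv t ≡ p) (sym (+-suc d t₀)) mv≡)
      in t , <⇒≤ t₀<t , trans loc≡ (loc-frame (step t₀) mv₀≢) , mvt≡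

    fair-next-move : StrongFair (inj₁ r) → ∀ {p T} → (∀ t → T ≤ t → Enabled (st t) (inp t) p) →
                     ∀ t₀ → ∃[ t ] (t₀ ≤ t × loc (st t) p ≡ loc (st t₀) p × mv t ≡ p)
    fair-next-move fair {p} {T} enabled t₀ =
      let t₁ , t₀≤t₁ , mv≡ = fair p (λ T' → T' + T , m≤m+n T' T , enabled (T' + T) (m≤n+m T T')) t₀
      in next-move (t₁ ∸ t₀) (subst (λ t → mv t ≡ p) (sym (m∸n+n≡m t₀≤t₁)) mv≡)

-- B-states: 0 is idle, suc p is the busy state p; A-states: 0 is initial, suc p is slot p,
-- through which A cycles downwards by prev.
module Construction (m : ℕ) where
  L : ℕ
  L = suc m

  K : ℕ
  K = suc L

  Q : Set
  Q = Fin K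

  prev : Fin L → Fin L
  prev zero = fromℕ m
  prev (suc p) = inject₁ p

  idle : Guard K K
  idle (inj₁ zero) = true
  idle (inj₁ (suc _)) = false
  idle (inj₂ zero) = true
  idle (inj₂ (suc _)) = false

  isA : Guard K K
  isA (inj₁ _) = true
  isA (inj₂ _) = false

  isB : Guard K K
  isB (inj₁ _) = false
  isB (inj₂ _) = true

  atB : Q → Guard K K
  atB j (inj₁ _) = false
  atB j (inj₂ x) = does (x ≟ j)

  atB-sound : ∀ {j l} → atB j l ≡ true → l ≡ inj₂ j
  atB-sound {j} {inj₂ x} h with x ≟ j | h
  ... | yes x≡j | _ = cong inj₂ x≡j

  atB-complete : ∀ {j x} → x ≡ j → atB j (inj₂ x) ≡ true
  atB-complete {j} {x} = dec-true (x ≟ j)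

  idle-A : ∀ {x} → idle (inj₁ x) ≡ true → x ≡ zero
  idle-A {zero} _ = refl

  idle-B : ∀ {x} → idle (inj₂ x) ≡ true → x ≡ zero
  idle-B {zero} _ = refl

  Rule : Set
  Rule = Q × Fin 1 × Guard K K × Q

  data ARule : Rule → Set where
    start   : ARule (zero , zero , isB , suc zero)
    restart : ∀ p → ARule (suc p , zero , isB , zero)
    advance : ∀ p → ARule (suc p , zero , atB (suc p) , suc (prev p))

  data BRule : Rule → Set where
    wake   : ∀ j → BRule (zero , zero , idle , j)
    linger : ∀ j → BRule (j , zero , atB j , j)
    reset  : ∀ p → BRule (suc p , zero , isA , zero)

  restarting advancing : Fin L → Rule
  restarting p = suc p , zero , isB , zero
  advancing p = suc p , zero , atB (suc p) , suc (prev p)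

  waking lingering : Q → Rule
  waking j = zero , zero , idle , j
  lingering j = j , zero , atB j , j

  resetting : Fin L → Rule
  resetting p = suc p , zero , isA , zero

  δA : List Rule
  δA = (zero , zero , isB , suc zero) ∷ map restarting (allFin L) ++ map advancing (allFin L)

  δB : List Rule
  δB = map waking (allFin K) ++ map lingering (allFin K) ++ map resetting (allFin L)

  ARule⇒∈δA : ∀ {tr} → ARule tr → tr ∈ δA
  ARule⇒∈δA start = here refl
  ARule⇒∈δA (restart p) = there (∈-++⁺ˡ (∈-map⁺ restarting (∈-allFin p)))
  ARule⇒∈δA (advance p) =
    there (∈-++⁺ʳ (map restarting (allFin L)) (∈-map⁺ advancing (∈-allFin p)))

  ∈δA⇒ARule : ∀ {tr} → tr ∈ δA → ARule tr
  ∈δA⇒ARule (here refl) = start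
  ∈δA⇒ARule (there tr∈) with ∈-++⁻ (map restarting (allFin L)) tr∈
  ... | inj₁ tr∈′ with p , _ , refl ← ∈-map⁻ restarting tr∈′ = restart p
  ... | inj₂ tr∈′ with p , _ , refl ← ∈-map⁻ advancing tr∈′ = advance p

  BRule⇒∈δB : ∀ {tr} → BRule tr → tr ∈ δB
  BRule⇒∈δB (wake j) = ∈-++⁺ˡ (∈-map⁺ waking (∈-allFin j))
  BRule⇒∈δB (linger j) =
    ∈-++⁺ʳ (map waking (allFin K)) (∈-++⁺ˡ (∈-map⁺ lingering (∈-allFin j)))
  BRule⇒∈δB (reset p) =
    ∈-++⁺ʳ (map waking (allFin K))
      (∈-++⁺ʳ (map lingering (allFin K)) (∈-map⁺ resetting (∈-allFin p)))

  ∈δB⇒BRule : ∀ {tr} → tr ∈ δB → BRule tr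
  ∈δB⇒BRule tr∈ with ∈-++⁻ (map waking (allFin K)) tr∈
  ... | inj₁ tr∈′ with j , _ , refl ← ∈-map⁻ waking tr∈′ = wake j
  ... | inj₂ tr∈′ with ∈-++⁻ (map lingering (allFin K)) tr∈′
  ...   | inj₁ tr∈″ with j , _ , refl ← ∈-map⁻ lingering tr∈″ = linger j
  ...   | inj₂ tr∈″ with p , _ , refl ← ∈-map⁻ resetting tr∈″ = reset p

  A : Template K K K
  A = record { nΣ = 1 ; init = zero ; δ = δA }

  B : Template K K K
  B = record { nΣ = 1 ; init = zero ; δ = δB }

  fin1-unique : (x : Fin 1) → zero ≡ x
  fin1-unique zero = refl

  module InSystem (n : ℕ) where
    open System A B n hiding (HasFairOrFiniteDeadlock)
    open RunProperties A B n

    A-enabled : ∀ {s e q g q'} → ARule (q , zero , g , q') → q ≡ sA s → GuardHolds s zero g →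
                Enabled s e zero
    A-enabled rule q≡ holds = _ , ARule⇒∈δA rule , q≡ , fin1-unique _ , holds

    B-enabled : ∀ {s e i q g q'} → BRule (q , zero , g , q') → q ≡ sB s i → GuardHolds s (suc i) g →
                Enabled s e (suc i)
    B-enabled rule q≡ holds = _ , BRule⇒∈δB rule , q≡ , fin1-unique _ , holds

    A-moves-by : ∀ {s e s' q g q'} → ARule (q , zero , g , q') → q ≡ sA s → GuardHolds s zero g →
                 q' ≡ sA s' → (∀ j → sB s' j ≡ sB s j) → Moves s e zero s'
    A-moves-by {e = e} rule q≡ holds q'≡ frame =
      (_ , proj₂ (A-enabled {e = e} rule q≡ holds) , q'≡) , frame

    B-moves-by : ∀ {s e s' i q g q'} → BRule (q , zero , g , q') → q ≡ sB s i →
                 GuardHolds s (suc i) g → q' ≡ sB s' i → sA s' ≡ sA s →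
                 (∀ j → j ≢ i → sB s' j ≡ sB s j) → Moves s e (suc i) s'
    B-moves-by {e = e} rule q≡ holds q'≡ sA≡ frame =
      (_ , proj₂ (B-enabled {e = e} rule q≡ holds) , q'≡) , sA≡ , frame

    B-holding : ∀ {s p j} → GuardHolds s p (atB j) → ∃[ q ] (suc q ≢ p × sB s q ≡ j)
    B-holding (zero , _ , ())
    B-holding (suc q , q≢p , holds) = q , q≢p , inj₂-injective (atB-sound holds)

    A-always-enabled : Fin n → ∀ s e → Enabled s e zero
    A-always-enabled i s e = from (sA s) refl
      where
      from : ∀ x → x ≡ sA s → Enabled s e zero
      from zero x≡ = A-enabled {e = e} start x≡ (suc i , (λ ()) , refl)
      from (suc p) x≡ = A-enabled {e = e} (restart p) x≡ (suc i , (λ ()) , refl)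

    busy-B-enabled : ∀ {s i p} e → sB s i ≡ suc p → Enabled s e (suc i)
    busy-B-enabled e sB≡ = B-enabled {e = e} (reset _) (sym sB≡) (zero , (λ ()) , refl)

    idle-B-enabled : ∀ {s i} e → sB s i ≡ zero → GuardHolds s (suc i) idle →
                     Enabled s e (suc i)
    idle-B-enabled e sB≡ = B-enabled {e = e} (wake zero) (sym sB≡)

    idle-B-enabled⇒other-idle : ∀ {s e i} → sB s i ≡ zero → Enabled s e (suc i) →
                                GuardHolds s (suc i) idle
    idle-B-enabled⇒other-idle sB≡ (_ , tr∈ , q≡ , _ , holds) with ∈δB⇒BRule tr∈
    ... | wake _ = holds
    ... | reset _ = ⊥-elim (0≢1+n (trans (sym sB≡) (sym q≡)))
    ... | linger _ with q , q≢ , sBq≡ ← B-holding holds =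
      suc q , q≢ , cong (idle ∘ inj₂) (trans sBq≡ (trans q≡ sB≡))

    busy-B-move : ∀ {s e s' i} → Moves s e (suc i) s' → sB s i ≢ zero → sB s' i ≢ zero →
                  sB s' i ≡ sB s i × ∃[ q ] (q ≢ i × sB s q ≡ sB s i)
    busy-B-move ((_ , (tr∈ , q≡ , _ , holds) , q'≡) , _) busy busy′ with ∈δB⇒BRule tr∈
    ... | wake _ = ⊥-elim (busy (sym q≡))
    ... | reset _ = ⊥-elim (busy′ (sym q'≡))
    ... | linger _ with q , q≢ , sBq≡ ← B-holding holds =
      trans (sym q'≡) q≡ , q , q≢ ∘ cong suc , trans sBq≡ q≡

    busy-A-move : ∀ {s e s' p} → Moves s e zero s' → sA s ≡ suc p → sA s' ≢ zero →
                  sA s' ≡ suc (prev p) × ∃[ q ] sB s q ≡ suc p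
    busy-A-move ((_ , (tr∈ , q≡ , _ , holds) , q'≡) , _) sA≡ busy′ with ∈δA⇒ARule tr∈
    ... | start = ⊥-elim (0≢1+n (trans q≡ sA≡))
    ... | restart _ = ⊥-elim (busy′ (sym q'≡))
    ... | advance _ with refl ← suc-injective (trans q≡ sA≡) | q , _ , sBq≡ ← B-holding holds =
      sym q'≡ , q , sBq≡

    module FairLocalDeadlock
      (r : InfRun) (fair : StrongFair (inj₁ r)) (v : Fin n) (T : ℕ)
      (stuck : ∀ t → T ≤ t → ¬ Enabled (InfRun.st r t) (InfRun.inp r t) (suc v)) where
      open InfRun r

      victim-idle : ∀ {t} → T ≤ t → sB (st t) v ≡ zero
      victim-idle {t} T≤t with sB (st t) v in sBv≡
      ... | zero = refl
      ... | suc _ = ⊥-elim (stuck t T≤t (busy-B-enabled (inp t) sBv≡))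

      not-victim : ∀ {t i p} → T ≤ t → sB (st t) i ≡ suc p → i ≢ v
      not-victim T≤t sBi≡ refl = 0≢1+n (trans (sym (victim-idle T≤t)) sBi≡)

      only-victim-idle : ∀ {t} → T ≤ t → ∀ p → p ≢ suc v → idle (loc (st t) p) ≢ true
      only-victim-idle {t} T≤t p p≢ idle≡ =
        stuck t T≤t (idle-B-enabled (inp t) (victim-idle T≤t) (p , p≢ , idle≡))

      A-busy : ∀ {t} → T ≤ t → sA (st t) ≢ zero
      A-busy T≤t sA≡ = only-victim-idle T≤t zero (λ ()) (cong (idle ∘ inj₁) sA≡)

      B-busy : ∀ {t i} → T ≤ t → i ≢ v → sB (st t) i ≢ zero
      B-busy T≤t i≢v sB≡ =
        only-victim-idle T≤t (suc _) (i≢v ∘ suc-injective) (cong (idle ∘ inj₂) sB≡)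

      B-still : ∀ {i} → i ≢ v → ∀ t → T ≤ t → sB (st (suc t)) i ≡ sB (st t) i
      B-still {i} i≢v t T≤t with mv t ≟ suc i
      ... | yes mv≡ =
        proj₁ (busy-B-move {e = inp t} (step-by r mv≡) (B-busy T≤t i≢v) (B-busy (m≤n⇒m≤1+n T≤t) i≢v))
      ... | no mv≢ = inj₂-injective (loc-frame (step t) mv≢)

      frozen : ∀ {i t} → i ≢ v → T ≤ t → sB (st t) i ≡ sB (st T) i
      frozen {i} i≢v =
        induction-from (λ t → sB (st t) i ≡ sB (st T) i) refl
                       (λ t T≤t frozen-t → trans (B-still i≢v t T≤t) frozen-t)

      config : Fin n → Q
      config i = sB (st T) i

      partnered : ∀ {q p} → config q ≡ suc p → ∃[ q' ] (q' ≢ q × config q' ≡ suc p)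
      partnered {q} {p} cq≡ =
        let t , T≤t , _ , mv≡ =
              fair-next-move r fair {p = suc q} (λ t T≤t → busy-B-enabled (inp t) (sBq≡ T≤t)) T
            _ , q' , q'≢q , sBq'≡ =
              busy-B-move {e = inp t} (step-by r mv≡) (B-busy T≤t q≢v) (B-busy (m≤n⇒m≤1+n T≤t) q≢v)
            sBq'≡p = trans sBq'≡ (sBq≡ T≤t)
        in q' , q'≢q , trans (sym (frozen (not-victim T≤t sBq'≡p) T≤t)) sBq'≡p
        where
        q≢v = not-victim ≤-refl cq≡
        sBq≡ : ∀ {t} → T ≤ t → sB (st t) q ≡ suc p
        sBq≡ T≤t = trans (frozen q≢v T≤t) cq≡

      Visits : Fin L → Set
      Visits x = ∃[ t ] (T ≤ t × sA (st t) ≡ suc x)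

      leaves : ∀ {x} → Visits x → (∃[ q ] config q ≡ suc x) × Visits (prev x)
      leaves (t₀ , T≤t₀ , sA≡) =
        let t , t₀≤t , loc≡ , mv≡ =
              fair-next-move r fair {p = zero} {T} (λ t _ → A-always-enabled v (st t) (inp t)) t₀
            T≤t = ≤-trans T≤t₀ t₀≤t
            sA'≡ , q , sBq≡ =
              busy-A-move {e = inp t} (step-by r mv≡) (trans (inj₁-injective loc≡) sA≡)
                          (A-busy (m≤n⇒m≤1+n T≤t))
        in (q , trans (sym (frozen (not-victim T≤t sBq≡) T≤t)) sBq≡) , suc t , m≤n⇒m≤1+n T≤t , sA'≡

      all-visited : ∀ x → Visits x
      all-visited =
        >-weakInduction Visits (proj₂ (leaves (reach-zero _ (proj₂ first)))) (λ _ → proj₂ ∘ leaves)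
        where
        reach-zero : ∀ x → Visits x → Visits zero
        reach-zero = <-weakInduction (λ x → Visits x → Visits zero) (λ visits → visits)
                                     (λ _ reach → reach ∘ proj₂ ∘ leaves)
        first : ∃[ x ] Visits x
        first with sA (st T) in sA≡
        ... | zero = ⊥-elim (A-busy ≤-refl sA≡)
        ... | suc x = x , T , ≤-refl , sA≡

      copies-needed : suc (L + L) ≤ n
      copies-needed = paired-fibres⇒≤ config (victim-idle ≤-refl) pairs
        where
        pairs : ∀ p → ∃[ i ] ∃[ j ] (i ≢ j × config i ≡ suc p × config j ≡ suc p)
        pairs p =
          let i , ci≡ = proj₁ (leaves (all-visited p))
              j , j≢i , cj≡ = partnered ci≡
          in i , j , j≢i ∘ sym , ci≡ , cj≡

    deadlock-free : 0 < n → n ≤ L + L → ¬ HasFairOrFiniteDeadlock A B n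
    deadlock-free 0<n _ (inj₂ run , _) = final zero (A-always-enabled (fromℕ< 0<n) (st len) (inp len))
      where open FinRun run
    deadlock-free 0<n _ (inj₁ run , inj₂ (zero , T , stuck) , _) =
      stuck T ≤-refl (A-always-enabled (fromℕ< 0<n) (st T) (inp T))
      where open InfRun run
    deadlock-free _ n≤ (inj₁ run , inj₂ (suc v , T , stuck) , inj₁ fair) =
      1+n≰n (≤-trans (FairLocalDeadlock.copies-needed run fair v T stuck) n≤)
    deadlock-free _ _ (inj₁ _ , inj₁ (_ , ()) , _)
    deadlock-free _ _ (inj₁ _ , inj₂ _ , inj₂ (_ , ()))

  -- B₀ is the victim; B₁₊ⱼ settles in busy state slot j, which it shares with B₁₊partner j.
  -- The schedule is round robin over A and B₁ … B_{2L}; after the first round every B is home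
  -- and A cycles through the slots for ever.
  module DeadlockingRun where
    N : ℕ
    N = L + L

    open System A B (suc N) hiding (HasFairOrFiniteDeadlock)
    open InSystem (suc N)

    slot : Fin N → Fin L
    slot = reduce ∘ splitAt L

    partner : Fin N → Fin N
    partner = join L L ∘ swap ∘ splitAt L

    slot-partner : ∀ j → slot (partner j) ≡ slot j
    slot-partner j =
      trans (cong reduce (splitAt-join L L (swap (splitAt L j)))) (reduce-swap (splitAt L j))
      where
      reduce-swap : ∀ (s : Fin L ⊎ Fin L) → reduce (swap s) ≡ reduce s
      reduce-swap (inj₁ _) = refl
      reduce-swap (inj₂ _) = refl

    partner-≢ : ∀ j → partner j ≢ j
    partner-≢ j e = swap-≢ (splitAt L j) (trans (sym (splitAt-join L L _)) (cong (splitAt L) e))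
      where
      swap-≢ : ∀ (s : Fin L ⊎ Fin L) → swap s ≢ s
      swap-≢ (inj₁ _) ()
      swap-≢ (inj₂ _) ()

    home : Fin (suc N) → Q
    home zero = zero
    home (suc j) = suc (slot j)

    cycle : Q → Q
    cycle zero = suc zero
    cycle (suc p) = suc (prev p)

    next : GState → Proc → GState
    next s zero = record s { sA = cycle (sA s) }
    next s (suc i) = record s { sB = updateAt (sB s) i (const (home i)) }

    next-home : ∀ s {p} i → p ≡ suc i → sB (next s p) i ≡ home i
    next-home s i refl = updateAt-updates i (sB s)

    next-other : ∀ {s p i} → p ≢ suc i → sB (next s p) i ≡ sB s i
    next-other {p = zero} _ = refl
    next-other {s} {suc i′} {i} p≢ = updateAt-minimal i i′ (sB s) (λ i≡ → p≢ (cong suc (sym i≡)))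

    next-keeps-home : ∀ {s i} p → sB s i ≡ home i → sB (next s p) i ≡ home i
    next-keeps-home {s} {i} p at-home with p ≟ suc i
    ... | yes p≡ = next-home s i p≡
    ... | no p≢ = trans (next-other p≢) at-home

    P : ℕ
    P = suc N

    turn : ℕ → Fin P
    turn t = t mod P

    scheduled : Fin P → Proc
    scheduled zero = zero
    scheduled (suc j) = suc (suc j)

    mover : ℕ → Proc
    mover t = scheduled (turn t)

    e₀ : GInput
    e₀ = record { eA = zero ; eB = λ _ → zero }

    state : ℕ → GState
    state zero = record { sA = zero ; sB = λ _ → zero }
    state (suc t) = next (state t) (mover t)

    stays-home : ∀ {i t} → sB (state t) i ≡ home i → ∀ t′ → t ≤ t′ → sB (state t′) i ≡ home i
    stays-home {i} at-home _ =
      induction-from (λ t → sB (state t) i ≡ home i) at-home (λ t _ → next-keeps-home (mover t))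

    victim-idle : ∀ t → sB (state t) zero ≡ zero
    victim-idle t = stays-home {t = 0} refl t z≤n

    toℕ-turn : ∀ {t} → t < P → toℕ (turn t) ≡ t
    toℕ-turn {t} t<P = trans (toℕ-fromℕ< _) (m<n⇒m%n≡m t<P)

    scheduled-B : ∀ {x j} → scheduled x ≡ suc (suc j) → x ≡ suc j
    scheduled-B {suc _} e = suc-injective e

    waiting : ∀ j {t} → t ≤ suc (toℕ j) → sB (state t) (suc j) ≡ zero
    waiting j {zero} _ = refl
    waiting j {suc t} (s≤s t≤j) = trans (next-other not-yet) (waiting j (m≤n⇒m≤1+n t≤j))
      where
      t<P : t < P
      t<P = s≤s (≤-trans t≤j (<⇒≤ (toℕ<n j)))
      not-yet : mover t ≢ suc (suc j)
      not-yet mv≡ =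
        1+n≰n (subst (_≤ toℕ j) (trans (sym (toℕ-turn t<P)) (cong toℕ (scheduled-B mv≡))) t≤j)

    placed : ∀ j → sB (state (suc (suc (toℕ j)))) (suc j) ≡ home (suc j)
    placed j = next-home _ (suc j) (cong scheduled (toℕ-injective (toℕ-turn (s≤s (toℕ<n j)))))

    settled : ∀ {t} → P ≤ t → ∀ i → sB (state t) i ≡ home i
    settled {t} _ zero = victim-idle t
    settled {t} P≤t (suc j) = stays-home (placed j) t (≤-trans (s≤s (toℕ<n j)) P≤t)

    A-busy : ∀ t → sA (state (suc t)) ≢ zero
    A-busy zero ()
    A-busy (suc t) with mover (suc t)
    ... | zero = cycle-busy (sA (state (suc t)))
      where
      cycle-busy : ∀ x → cycle x ≢ zero
      cycle-busy zero ()
      cycle-busy (suc _) ()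
    ... | suc _ = A-busy t

    slot-occupied : ∀ {t} → P ≤ t → ∀ p → GuardHolds (state t) zero (atB (suc p))
    slot-occupied P≤t p =
      suc (suc (p ↑ˡ L)) , (λ ()) ,
      atB-complete (trans (settled P≤t (suc (p ↑ˡ L))) (cong (suc ∘ reduce) (splitAt-↑ˡ L p L)))

    partner-holds : ∀ {t} → P ≤ t → ∀ j →
                    GuardHolds (state t) (suc (suc j)) (atB (home (suc j)))
    partner-holds P≤t j =
      suc (suc (partner j)) , partner-≢ j ∘ suc-injective ∘ suc-injective ,
      atB-complete (trans (settled P≤t (suc (partner j))) (cong suc (slot-partner j)))

    A-late : ∀ t {p} → turn t ≡ zero → sA (state t) ≡ suc p → P ≤ t
    A-late t turn≡ sA≡ with t <? P
    ... | no t≮P = ≮⇒≥ t≮P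
    ... | yes t<P with refl ← trans (sym (toℕ-turn t<P)) (cong toℕ turn≡) = ⊥-elim (0≢1+n sA≡)

    A-step : ∀ t → turn t ≡ zero → Moves (state t) e₀ zero (next (state t) zero)
    A-step t turn≡ = from (sA (state t)) refl
      where
      from : ∀ x → x ≡ sA (state t) → Moves (state t) e₀ zero (next (state t) zero)
      from zero x≡ =
        A-moves-by {state t} {e₀} start x≡ (suc zero , (λ ()) , refl) (cong cycle x≡) (λ _ → refl)
      from (suc p) x≡ =
        A-moves-by {state t} {e₀} (advance p) x≡ (slot-occupied (A-late t turn≡ (sym x≡)) p)
                   (cong cycle x≡) (λ _ → refl)

    B-goes-home : ∀ t j {q g} → BRule (q , zero , g , home (suc j)) → q ≡ sB (state t) (suc j) →
                  GuardHolds (state t) (suc (suc j)) g →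
                  Moves (state t) e₀ (suc (suc j)) (next (state t) (suc (suc j)))
    B-goes-home t j rule q≡ holds =
      B-moves-by {state t} {e₀} rule q≡ holds (sym (next-home (state t) (suc j) refl)) refl
                 (λ k k≢ → next-other {state t} {suc (suc j)} {k} (k≢ ∘ sym ∘ suc-injective))

    B-step : ∀ t {j} → turn t ≡ suc j → Moves (state t) e₀ (suc (suc j)) (next (state t) (suc (suc j)))
    B-step t {j} turn≡ with t <? P
    ... | yes t<P =
      B-goes-home t j (wake (home (suc j))) (sym (waiting j (≤-reflexive t≡)))
                  (suc zero , (λ ()) , cong (idle ∘ inj₂) (victim-idle t))
      where
      t≡ : t ≡ suc (toℕ j)
      t≡ = trans (sym (toℕ-turn t<P)) (cong toℕ turn≡)
    ... | no t≮P =
      B-goes-home t j (linger (home (suc j))) (sym (settled P≤t (suc j))) (partner-holds P≤t j)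
      where
      P≤t : P ≤ t
      P≤t = ≮⇒≥ t≮P

    step : ∀ t → Moves (state t) e₀ (mover t) (state (suc t))
    step t with turn t in turn≡
    ... | zero = A-step t turn≡
    ... | suc j = B-step t turn≡

    e₀-frame : ∀ p → InputFrame e₀ p e₀
    e₀-frame zero = λ _ → refl
    e₀-frame (suc _) = refl , λ _ _ → refl

    run : InfRun
    run = record
      { st = state ; inp = const e₀ ; mv = mover
      ; start = refl , (λ _ → refl) ; step = step ; inFrame = e₀-frame ∘ mover }

    others-busy : ∀ {t} → P ≤ t → ∀ p → p ≢ suc zero → idle (loc (state t) p) ≢ true
    others-busy {zero} ()
    others-busy {suc t} _ zero _ idle≡ = A-busy t (idle-A idle≡)
    others-busy _ (suc zero) p≢ _ = p≢ refl
    others-busy P≤t (suc (suc j)) _ idle≡ =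
      0≢1+n (trans (sym (idle-B idle≡)) (settled P≤t (suc j)))

    victim-disabled : ∀ {t} → P ≤ t → ¬ Enabled (state t) e₀ (suc zero)
    victim-disabled {t} P≤t enabled =
      let p , p≢ , idle≡ = idle-B-enabled⇒other-idle {e = e₀} (victim-idle t) enabled
      in others-busy P≤t p p≢ idle≡

    recurring : ∀ x T′ → ∃[ t ] (T′ ≤ t × turn t ≡ x)
    recurring x T′ = toℕ x + T′ * P , ≤-trans (m≤m*n T′ P) (m≤n+m _ _) , toℕ-injective (
      begin
      toℕ (turn (toℕ x + T′ * P)) ≡⟨ toℕ-fromℕ< _ ⟩
      (toℕ x + T′ * P) % P        ≡⟨ [m+kn]%n≡m%n (toℕ x) T′ P ⟩
      toℕ x % P                   ≡⟨ m<n⇒m%n≡m (toℕ<n x) ⟩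
      toℕ x                       ∎)
      where open ≡-Reasoning

    scheduled-often : ∀ x T′ → ∃[ t ] (T′ ≤ t × mover t ≡ scheduled x)
    scheduled-often x T′ = let t , T′≤t , turn≡ = recurring x T′ in t , T′≤t , cong scheduled turn≡

    fair : StrongFair (inj₁ run)
    fair zero _ = scheduled-often zero
    fair (suc zero) enabled _ = let t , P≤t , en = enabled P in ⊥-elim (victim-disabled P≤t en)
    fair (suc (suc j)) _ = scheduled-often (suc j)

    deadlock : HasFairOrFiniteDeadlock A B (suc N)
    deadlock = inj₁ run , inj₂ (suc zero , P , λ _ → victim-disabled) , inj₁ fair

2k∸2≡L+L : ∀ m → 2 * suc (suc m) ∸ 2 ≡ suc m + suc m
2k∸2≡L+L m = trans (+-suc m (suc (m + 0))) (cong (λ x → suc (m + suc x)) (+-identityʳ m))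

mainTheorem8 : (k : ℕ) → 2 ≤ k →
    ∃[ qa ] Σ (Template qa k qa) (λ A → Σ (Template qa k k) (λ B →
      ¬ HasFairOrFiniteDeadlock A B (2 * k ∸ 2)
      × HasFairOrFiniteDeadlock A B (2 * k ∸ 1)))
mainTheorem8 (suc (suc m)) (s≤s (s≤s z≤n)) = K , A , B , no-deadlock , deadlock′
  where
  open Construction m
  no-deadlock : ¬ HasFairOrFiniteDeadlock A B (2 * suc (suc m) ∸ 2)
  no-deadlock = subst (λ n → ¬ HasFairOrFiniteDeadlock A B n) (sym (2k∸2≡L+L m))
                      (InSystem.deadlock-free (L + L) (s≤s z≤n) ≤-refl)
  deadlock′ : HasFairOrFiniteDeadlock A B (2 * suc (suc m) ∸ 1)
  deadlock′ = subst (HasFairOrFiniteDeadlock A B) (sym (cong suc (2k∸2≡L+L m)))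
                    DeadlockingRun.deadlock
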